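{- Let $k$ be a positive integer and $t$ an indeterminate. Then, as formal power series in $x$, $$(1-t^kx)^{k+1}(1+t^kx)^k\sum_{n=0}^{\infty}\binom{\lfloor\frac{n+k}{2}\rfloor}{\lfloor\frac{k}{2}\rfloor}\binom{\lfloor\frac{n+k+1}{2}\rfloor}{\lfloor\frac{k+1}{2}\rfloor}t^{kn}x^n=\sum_{j=0}^{k}\binom{\lfloor\frac{k-1}{2}\rfloor}{\lfloor\frac{j}{2}\rfloor}\binom{\lfloor\frac{k}{2}\rfloor}{\lfloor\frac{j+1}{2}\rfloor}t^{kj}x^j.$$
   Context: Binomial coefficients $\binom{a}{b}$ with $b>a\ge 0$ are $0$; $\lfloor\cdot\rfloor$ is the floor function. -}

module Defs where

open import Data.Nat as ℕ using (ℕ; zero; suc; _∸_; _≡ᵇ_; _≤ᵇ_; _/_)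
open import Data.Nat.Combinatorics using (_C_)
open import Data.Integer as ℤ using (ℤ; +_; -_; _+_; _*_)
open import Data.Bool using (Bool; if_then_else_; _∧_)

-- A formal power series in x with coefficients in ℤ[t], represented by its
-- coefficient array: f n m = coefficient of x^n t^m.
-- (ℤ[t][[x]] embeds in ℤ[[x,t]]; multiplication is the Cauchy product.)
Series : Set
Series = ℕ → ℕ → ℤ

sumTo : ℕ → (ℕ → ℤ) → ℤ
sumTo zero f = f 0
sumTo (suc n) f = sumTo n f + f (suc n)

_⊛_ : Series → Series → Series
(f ⊛ g) n m = sumTo n λ i → sumTo m λ j → f i j * g (n ∸ i) (m ∸ j)

infixl 7 _⊛_

one : Series
one n m = if (n ≡ᵇ 0) ∧ (m ≡ᵇ 0) then + 1 else + 0

_⊛^_ : Series → ℕ → Series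
f ⊛^ zero = one
f ⊛^ suc e = f ⊛ (f ⊛^ e)

linear : ℤ → ℕ → Series
linear s k n m =
  if (n ≡ᵇ 0) ∧ (m ≡ᵇ 0) then + 1
  else if (n ≡ᵇ 1) ∧ (m ≡ᵇ k) then s else + 0

diagSeries : ℕ → (ℕ → ℕ) → Series
diagSeries k c n m = if m ≡ᵇ k ℕ.* n then + c n else + 0

lhsCoeff : ℕ → ℕ → ℕ
lhsCoeff k n = (((n ℕ.+ k) / 2) C (k / 2)) ℕ.* (((n ℕ.+ k ℕ.+ 1) / 2) C ((k ℕ.+ 1) / 2))

rhsCoeff : ℕ → ℕ → ℕ
rhsCoeff k j = if j ≤ᵇ k
  then (((k ∸ 1) / 2) C (j / 2)) ℕ.* ((k / 2) C ((j ℕ.+ 1) / 2))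
  else 0

LHS : ℕ → Series
LHS k = (linear (- + 1) k ⊛^ (k ℕ.+ 1)) ⊛ (linear (+ 1) k ⊛^ k) ⊛ diagSeries k (lhsCoeff k)

RHS : ℕ → Series
RHS k = diagSeries k (rhsCoeff k)

-- Every factor of the left-hand side is a power series in tᵏx, so the theorem is the univariate
-- identity (1 - x)^(k+1) (1 + x)^k A(x) = B(x) for the coefficient sequences A = lhsCoeff k and
-- B = rhsCoeff k. Since (1 - x)(1 + x) = 1 - x², on even and odd parts it reads
--   (1 - y)^k (A_ev - y A_od) = B_ev   and   (1 - y)^k (A_od - A_ev) = B_od.
-- Let a = ⌊k/2⌋, b = ⌈k/2⌉ and let c_a(r) = C(r+a, a) be the coefficients of (1 - y)^-(a+1).
-- Pascal's rule turns A_ev - y A_od into c_a c_(b-1), and A_od - A_ev into the shift of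
-- c_(a-1) c_b - c_(a-1) c_(b-1) (it vanishes when k = 1). Both identities then follow from
--   (1 - y)^(a+b+1) Σ_r c_a(r) c_b(r) yʳ = Σ_i C(a, i) C(b, i) yⁱ,
-- proved by induction on a and b.

module Submission where

open import Defs
open import Data.Nat using (ℕ; _≤_)
open import Relation.Binary.PropositionalEquality using (_≡_)

open import Data.Bool using (true; false; if_then_else_; T)
open import Data.Bool.Properties using (if-eta)
open import Data.Empty using (⊥-elim)
open import Data.Integer using (ℤ; +_; -_; _+_; _-_; _*_; 0ℤ; 1ℤ; -1ℤ)
import Data.Integer.Properties as ℤₚ
open import Data.Integer.Tactic.RingSolver using (solve-∀)
open import Data.Nat as ℕ using (zero; suc; z≤n; s≤s; _∸_; _/_; _≡ᵇ_)
open import Data.Nat.Combinatorics using (_C_; nCn≡1; nCk+nC[k+1]≡[n+1]C[k+1]; k>n⇒nCk≡0)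
open import Data.Nat.DivMod using (m/n≡1+[m∸n]/n; /-monoˡ-≤)
import Data.Nat.Properties as ℕₚ
open import Function using (_∘_)
open import Relation.Binary.PropositionalEquality
  using (_≗_; _≢_; refl; sym; trans; cong; cong₂; subst; module ≡-Reasoning)
open import Relation.Nullary using (¬_; yes; no)
open import Relation.Nullary.Decidable using (dec-true; dec-false)

Seq : Set
Seq = ℕ → ℤ

sumTo-cong : ∀ n {f g : Seq} → (∀ i → i ≤ n → f i ≡ g i) → sumTo n f ≡ sumTo n g
sumTo-cong zero    f≡g = f≡g 0 z≤n
sumTo-cong (suc n) f≡g =
  cong₂ _+_ (sumTo-cong n λ i i≤n → f≡g i (ℕₚ.m≤n⇒m≤1+n i≤n)) (f≡g (suc n) ℕₚ.≤-refl)

sumTo-zero : ∀ n {f : Seq} → (∀ i → i ≤ n → f i ≡ 0ℤ) → sumTo n f ≡ 0ℤ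
sumTo-zero zero    f≡0 = f≡0 0 z≤n
sumTo-zero (suc n) f≡0 =
  cong₂ _+_ (sumTo-zero n λ i i≤n → f≡0 i (ℕₚ.m≤n⇒m≤1+n i≤n)) (f≡0 (suc n) ℕₚ.≤-refl)

sumTo-single : ∀ n c {f : Seq} → c ≤ n → (∀ i → i ≢ c → f i ≡ 0ℤ) → sumTo n f ≡ f c
sumTo-single zero    .0 z≤n _   = refl
sumTo-single (suc n) c {f} c≤1+n f≡0 with c ℕₚ.≟ suc n
... | yes refl = trans (cong (_+ f (suc n)) (sumTo-zero n λ i i≤n → f≡0 i (ℕₚ.<⇒≢ (s≤s i≤n))))
                       (ℤₚ.+-identityˡ _)
... | no c≢1+n = trans (cong₂ _+_ (sumTo-single n c (ℕₚ.≤-pred (ℕₚ.≤∧≢⇒< c≤1+n c≢1+n)) f≡0)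
                                  (f≡0 (suc n) (c≢1+n ∘ sym)))
                       (ℤₚ.+-identityʳ _)

sumTo-+ : ∀ n (f g : Seq) → sumTo n (λ i → f i + g i) ≡ sumTo n f + sumTo n g
sumTo-+ zero    f g = refl
sumTo-+ (suc n) f g = trans (cong (_+ (f (suc n) + g (suc n))) (sumTo-+ n f g))
                            (interchange (sumTo n f) (sumTo n g) (f (suc n)) (g (suc n)))
  where
  interchange : ∀ a b c d → (a + b) + (c + d) ≡ (a + c) + (b + d)
  interchange = solve-∀

sumTo-*ˡ : ∀ n c (f : Seq) → sumTo n (λ i → c * f i) ≡ c * sumTo n f
sumTo-*ˡ zero    c f = refl
sumTo-*ˡ (suc n) c f = trans (cong (_+ c * f (suc n)) (sumTo-*ˡ n c f))
                             (sym (ℤₚ.*-distribˡ-+ c (sumTo n f) (f (suc n))))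

sumTo-suc : ∀ n (f : Seq) → sumTo (suc n) f ≡ f 0 + sumTo n (f ∘ suc)
sumTo-suc zero    f = refl
sumTo-suc (suc n) f = trans (cong (_+ f (suc (suc n))) (sumTo-suc n f))
                            (ℤₚ.+-assoc (f 0) (sumTo n (f ∘ suc)) (f (suc (suc n))))

δ : Seq
δ zero    = 1ℤ
δ (suc _) = 0ℤ

infixl 7 _∗_
infixl 6 _+ₛ_ _-ₛ_
infixr 8 [1+_x]·_ [1+_x]^_·_

_∗_ : Seq → Seq → Seq
(f ∗ g) n = sumTo n λ i → f i * g (n ∸ i)

_+ₛ_ _-ₛ_ : Seq → Seq → Seq
(f +ₛ g) n = f n + g n
(f -ₛ g) n = f n - g n

[1+_x]·_ : ℤ → Seq → Seq
([1+ s x]· f) zero    = f zero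
([1+ s x]· f) (suc n) = f (suc n) + s * f n

[1+_x]^_·_ : ℤ → ℕ → Seq → Seq
[1+ s x]^ zero  · f = f
[1+ s x]^ suc e · f = [1+ s x]· [1+ s x]^ e · f

·-cong : ∀ s {f g} → f ≗ g → [1+ s x]· f ≗ [1+ s x]· g
·-cong s f≗g zero    = f≗g 0
·-cong s f≗g (suc n) = cong₂ (λ a b → a + s * b) (f≗g (suc n)) (f≗g n)

^·-cong : ∀ s e {f g} → f ≗ g → [1+ s x]^ e · f ≗ [1+ s x]^ e · g
^·-cong s zero    f≗g = f≗g
^·-cong s (suc e) f≗g = ·-cong s (^·-cong s e f≗g)

∗-congˡ : ∀ {f f′} g → f ≗ f′ → f ∗ g ≗ f′ ∗ g
∗-congˡ g f≗f′ n = sumTo-cong n λ i _ → cong (_* g (n ∸ i)) (f≗f′ i)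

δ-∗ : ∀ g → δ ∗ g ≗ g
δ-∗ g n = trans (sumTo-single n 0 z≤n δi≡0) (ℤₚ.*-identityˡ (g n))
  where
  δi≡0 : ∀ i → i ≢ 0 → δ i * g (n ∸ i) ≡ 0ℤ
  δi≡0 zero    i≢0 = ⊥-elim (i≢0 refl)
  δi≡0 (suc i) _   = refl

·-∗ : ∀ s f g → ([1+ s x]· f) ∗ g ≗ [1+ s x]· (f ∗ g)
·-∗ s f g zero    = refl
·-∗ s f g (suc n) = begin
  (([1+ s x]· f) ∗ g) (suc n)
    ≡⟨ sumTo-suc n _ ⟩
  f 0 * g (suc n) + sumTo n (λ i → (f (suc i) + s * f i) * g (n ∸ i))
    ≡⟨ cong (_+_ (f 0 * g (suc n))) (begin
         sumTo n (λ i → (f (suc i) + s * f i) * g (n ∸ i))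
           ≡⟨ sumTo-cong n (λ i _ → distrib s (f (suc i)) (f i) (g (n ∸ i))) ⟩
         sumTo n (λ i → f (suc i) * g (n ∸ i) + s * (f i * g (n ∸ i)))
           ≡⟨ sumTo-+ n _ _ ⟩
         sumTo n (λ i → f (suc i) * g (n ∸ i)) + sumTo n (λ i → s * (f i * g (n ∸ i)))
           ≡⟨ cong (_+_ (sumTo n (λ i → f (suc i) * g (n ∸ i)))) (sumTo-*ˡ n s _) ⟩
         sumTo n (λ i → f (suc i) * g (n ∸ i)) + s * (f ∗ g) n ∎) ⟩
  f 0 * g (suc n) + (sumTo n (λ i → f (suc i) * g (n ∸ i)) + s * (f ∗ g) n)
    ≡⟨ sym (ℤₚ.+-assoc (f 0 * g (suc n)) _ _) ⟩
  (f 0 * g (suc n) + sumTo n (λ i → f (suc i) * g (n ∸ i))) + s * (f ∗ g) n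
    ≡⟨ cong (_+ s * (f ∗ g) n) (sym (sumTo-suc n λ i → f i * g (suc n ∸ i))) ⟩
  ([1+ s x]· (f ∗ g)) (suc n) ∎
  where
  open ≡-Reasoning
  distrib : ∀ s a b c → (a + s * b) * c ≡ a * c + s * (b * c)
  distrib = solve-∀

^·-∗ : ∀ s e f g → ([1+ s x]^ e · f) ∗ g ≗ [1+ s x]^ e · (f ∗ g)
^·-∗ s zero    f g n = refl
^·-∗ s (suc e) f g n = trans (·-∗ s ([1+ s x]^ e · f) g n) (·-cong s (^·-∗ s e f g) n)

^·δ-∗ : ∀ s e g → ([1+ s x]^ e · δ) ∗ g ≗ [1+ s x]^ e · g
^·δ-∗ s e g n = trans (^·-∗ s e δ g n) (^·-cong s e (δ-∗ g) n)

·-comm : ∀ s t f → [1+ s x]· [1+ t x]· f ≗ [1+ t x]· [1+ s x]· f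
·-comm s t f zero          = refl
·-comm s t f (suc zero)    = swap s t (f 1) (f 0)
  where
  swap : ∀ s t a b → a + t * b + s * b ≡ a + s * b + t * b
  swap = solve-∀
·-comm s t f (suc (suc n)) = swap s t (f (suc (suc n))) (f (suc n)) (f n)
  where
  swap : ∀ s t a b c → a + t * b + s * (b + t * c) ≡ a + s * b + t * (b + s * c)
  swap = solve-∀

^·-comm : ∀ s t e f → [1+ s x]^ e · [1+ t x]· f ≗ [1+ t x]· [1+ s x]^ e · f
^·-comm s t zero    f n = refl
^·-comm s t (suc e) f n =
  trans (·-cong s (^·-comm s t e f) n) (·-comm s t ([1+ s x]^ e · f) n)

·-+ₛ : ∀ s f g → [1+ s x]· (f +ₛ g) ≗ [1+ s x]· f +ₛ [1+ s x]· g
·-+ₛ s f g zero    = refl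
·-+ₛ s f g (suc n) = distrib s (f (suc n)) (g (suc n)) (f n) (g n)
  where
  distrib : ∀ s a b c d → a + b + s * (c + d) ≡ a + s * c + (b + s * d)
  distrib = solve-∀

·--ₛ : ∀ s f g → [1+ s x]· (f -ₛ g) ≗ [1+ s x]· f -ₛ [1+ s x]· g
·--ₛ s f g zero    = refl
·--ₛ s f g (suc n) = distrib s (f (suc n)) (g (suc n)) (f n) (g n)
  where
  distrib : ∀ s a b c d → a - b + s * (c - d) ≡ a + s * c - (b + s * d)
  distrib = solve-∀

^·-+ₛ : ∀ s e f g → [1+ s x]^ e · (f +ₛ g) ≗ [1+ s x]^ e · f +ₛ [1+ s x]^ e · g
^·-+ₛ s zero    f g n = refl
^·-+ₛ s (suc e) f g n = trans (·-cong s (^·-+ₛ s e f g) n) (·-+ₛ s _ _ n)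

^·--ₛ : ∀ s e f g → [1+ s x]^ e · (f -ₛ g) ≗ [1+ s x]^ e · f -ₛ [1+ s x]^ e · g
^·--ₛ s zero    f g n = refl
^·--ₛ s (suc e) f g n = trans (·-cong s (^·--ₛ s e f g) n) (·--ₛ s _ _ n)

^·-exp : ∀ s {e e′} f → e ≡ e′ → [1+ s x]^ e · f ≗ [1+ s x]^ e′ · f
^·-exp s f refl n = refl

^·-at0 : ∀ s e f → ([1+ s x]^ e · f) 0 ≡ f 0
^·-at0 s zero    f = refl
^·-at0 s (suc e) f = ^·-at0 s e f

·-∘suc : ∀ s u → u 0 ≡ 0ℤ → [1+ s x]· (u ∘ suc) ≗ ([1+ s x]· u) ∘ suc
·-∘suc s u u0≡0 zero    = sym (trans (cong (λ c → u 1 + s * c) u0≡0)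
                                     (trans (cong (_+_ (u 1)) (ℤₚ.*-zeroʳ s)) (ℤₚ.+-identityʳ (u 1))))
·-∘suc s u u0≡0 (suc n) = refl

^·-∘suc : ∀ s e u → u 0 ≡ 0ℤ → [1+ s x]^ e · (u ∘ suc) ≗ ([1+ s x]^ e · u) ∘ suc
^·-∘suc s zero    u u0≡0 n = refl
^·-∘suc s (suc e) u u0≡0 n =
  trans (·-cong s (^·-∘suc s e u u0≡0) n) (·-∘suc s ([1+ s x]^ e · u) (trans (^·-at0 s e u) u0≡0) n)

infix 4 _≋_
_≋_ : Series → Series → Set
F ≋ G = ∀ n m → F n m ≡ G n m

⊛-cong : ∀ {F F′ G G′} → F ≋ F′ → G ≋ G′ → F ⊛ G ≋ F′ ⊛ G′
⊛-cong F≋F′ G≋G′ n m =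
  sumTo-cong n λ i _ → sumTo-cong m λ j _ → cong₂ _*_ (F≋F′ i j) (G≋G′ (n ∸ i) (m ∸ j))

⊛-congˡ : ∀ {F F′} G → F ≋ F′ → F ⊛ G ≋ F′ ⊛ G
⊛-congˡ G F≋F′ = ⊛-cong {G = G} F≋F′ λ _ _ → refl

diag : ℕ → Seq → Series
diag k f n m = if m ≡ᵇ k ℕ.* n then f n else 0ℤ

diag-cong : ∀ k {f g} → f ≗ g → diag k f ≋ diag k g
diag-cong k f≗g n m = cong (λ c → if m ≡ᵇ k ℕ.* n then c else 0ℤ) (f≗g n)

diag-on : ∀ k f n → diag k f n (k ℕ.* n) ≡ f n
diag-on k f n = cong (λ b → if b then f n else 0ℤ) (dec-true (k ℕ.* n ℕₚ.≟ k ℕ.* n) refl)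

diag-off : ∀ k f {n m} → m ≢ k ℕ.* n → diag k f n m ≡ 0ℤ
diag-off k f {n} {m} m≢kn = cong (λ b → if b then f n else 0ℤ) (dec-false (m ℕₚ.≟ k ℕ.* n) m≢kn)

diag-⊛ : ∀ k f g → diag k f ⊛ diag k g ≋ diag k (f ∗ g)
diag-⊛ k f g n m with m ℕₚ.≟ k ℕ.* n
... | yes refl = trans (sumTo-cong n onDiagonal) (sym (diag-on k (f ∗ g) n))
  where
  onDiagonal : ∀ i → i ≤ n →
    sumTo (k ℕ.* n) (λ j → diag k f i j * diag k g (n ∸ i) (k ℕ.* n ∸ j)) ≡ f i * g (n ∸ i)
  onDiagonal i i≤n = trans
    (sumTo-single (k ℕ.* n) (k ℕ.* i) (ℕₚ.*-monoʳ-≤ k i≤n)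
                  (λ j j≢ki → cong (_* _) (diag-off k f j≢ki)))
    (cong₂ _*_ (diag-on k f i)
               (trans (cong (diag k g (n ∸ i)) (sym (ℕₚ.*-distribˡ-∸ k n i))) (diag-on k g (n ∸ i))))
... | no m≢kn = trans (sumTo-zero n λ i i≤n → sumTo-zero m (vanish i i≤n)) (sym (diag-off k (f ∗ g) m≢kn))
  where
  vanish : ∀ i → i ≤ n → ∀ j → j ≤ m → diag k f i j * diag k g (n ∸ i) (m ∸ j) ≡ 0ℤ
  vanish i i≤n j j≤m with j ℕₚ.≟ k ℕ.* i
  ... | no j≢ki  = cong (_* _) (diag-off k f j≢ki)
  ... | yes refl = trans (cong (diag k f i (k ℕ.* i) *_) (diag-off k g (m≢kn ∘ m≡kn)))
                         (ℤₚ.*-zeroʳ (diag k f i (k ℕ.* i)))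
    where
    open ≡-Reasoning
    m≡kn : m ∸ k ℕ.* i ≡ k ℕ.* (n ∸ i) → m ≡ k ℕ.* n
    m≡kn eq = begin
      m                            ≡⟨ ℕₚ.m∸n+n≡m j≤m ⟨
      m ∸ k ℕ.* i ℕ.+ k ℕ.* i      ≡⟨ cong (ℕ._+ k ℕ.* i) eq ⟩
      k ℕ.* (n ∸ i) ℕ.+ k ℕ.* i    ≡⟨ ℕₚ.*-distribˡ-+ k (n ∸ i) i ⟨
      k ℕ.* (n ∸ i ℕ.+ i)          ≡⟨ cong (k ℕ.*_) (ℕₚ.m∸n+n≡m i≤n) ⟩
      k ℕ.* n                      ∎

one≋diag : ∀ k → one ≋ diag k δ
one≋diag k zero    m rewrite ℕₚ.*-zeroʳ k = refl
one≋diag k (suc n) m = sym (if-eta (m ≡ᵇ k ℕ.* suc n))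

linear≋diag : ∀ s k → linear s k ≋ diag k ([1+ s x]· δ)
linear≋diag s k zero          m rewrite ℕₚ.*-zeroʳ k = refl
linear≋diag s k (suc zero)    m rewrite ℕₚ.*-identityʳ k =
  cong (λ c → if m ≡ᵇ k then c else 0ℤ) (sym (trans (ℤₚ.+-identityˡ (s * 1ℤ)) (ℤₚ.*-identityʳ s)))
linear≋diag s k (suc (suc n)) m = sym (trans
  (cong (λ c → if m ≡ᵇ k ℕ.* suc (suc n) then 0ℤ + c else 0ℤ) (ℤₚ.*-zeroʳ s))
  (if-eta (m ≡ᵇ k ℕ.* suc (suc n))))

linear⊛^≋diag : ∀ s k e → linear s k ⊛^ e ≋ diag k ([1+ s x]^ e · δ)
linear⊛^≋diag s k zero    = one≋diag k
linear⊛^≋diag s k (suc e) n m = begin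
  (linear s k ⊛ linear s k ⊛^ e) n m
    ≡⟨ ⊛-cong (linear≋diag s k) (linear⊛^≋diag s k e) n m ⟩
  (diag k ([1+ s x]· δ) ⊛ diag k ([1+ s x]^ e · δ)) n m
    ≡⟨ diag-⊛ k ([1+ s x]· δ) ([1+ s x]^ e · δ) n m ⟩
  diag k ([1+ s x]· δ ∗ [1+ s x]^ e · δ) n m
    ≡⟨ diag-cong k (^·δ-∗ s 1 ([1+ s x]^ e · δ)) n m ⟩
  diag k ([1+ s x]^ suc e · δ) n m ∎
  where open ≡-Reasoning

lhs rhs : ℕ → Seq
lhs k n = + lhsCoeff k n
rhs k n = + rhsCoeff k n

LHS≋diag : ∀ k → LHS k ≋ diag k ([1+ -1ℤ x]^ (k ℕ.+ 1) · [1+ 1ℤ x]^ k · lhs k)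
LHS≋diag k n m = begin
  LHS k n m
    ≡⟨ ⊛-congˡ (diag k (lhs k)) (⊛-cong (linear⊛^≋diag -1ℤ k (k ℕ.+ 1)) (linear⊛^≋diag 1ℤ k k)) n m ⟩
  ((diag k P ⊛ diag k Q) ⊛ diag k (lhs k)) n m
    ≡⟨ ⊛-congˡ (diag k (lhs k)) (diag-⊛ k P Q) n m ⟩
  (diag k (P ∗ Q) ⊛ diag k (lhs k)) n m
    ≡⟨ diag-⊛ k (P ∗ Q) (lhs k) n m ⟩
  diag k (P ∗ Q ∗ lhs k) n m
    ≡⟨ diag-cong k PQA≗ n m ⟩
  diag k ([1+ -1ℤ x]^ (k ℕ.+ 1) · [1+ 1ℤ x]^ k · lhs k) n m ∎
  where
  open ≡-Reasoning
  P = [1+ -1ℤ x]^ (k ℕ.+ 1) · δ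
  Q = [1+ 1ℤ x]^ k · δ
  PQA≗ : P ∗ Q ∗ lhs k ≗ [1+ -1ℤ x]^ (k ℕ.+ 1) · [1+ 1ℤ x]^ k · lhs k
  PQA≗ i = trans (∗-congˡ (lhs k) (^·δ-∗ -1ℤ (k ℕ.+ 1) Q) i)
           (trans (^·-∗ -1ℤ (k ℕ.+ 1) Q (lhs k) i)
                  (^·-cong -1ℤ (k ℕ.+ 1) (^·δ-∗ 1ℤ k (lhs k)) i))

double : ℕ → ℕ
double zero    = zero
double (suc r) = suc (suc (double r))

data ParityView : ℕ → Set where
  even : ∀ r → ParityView (double r)
  odd  : ∀ r → ParityView (suc (double r))

parityView : ∀ n → ParityView n
parityView zero = even 0
parityView (suc n) with parityView n
... | even r = odd r
... | odd r  = even (suc r)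

evens odds : {A : Set} → (ℕ → A) → ℕ → A
evens f r = f (double r)
odds  f r = f (suc (double r))

≗-byParity : ∀ {A : Set} {f g : ℕ → A} → evens f ≗ evens g → odds f ≗ odds g → f ≗ g
≗-byParity         ev od zero          = ev 0
≗-byParity         ev od (suc zero)    = od 0
≗-byParity {f = f} {g} ev od (suc (suc n)) =
  ≗-byParity {f = f ∘ suc ∘ suc} {g ∘ suc ∘ suc} (ev ∘ suc) (od ∘ suc) n

evens-[1-x²] : ∀ s h → evens ([1+ - s x]· [1+ s x]· h) ≗ [1+ - (s * s) x]· evens h
evens-[1-x²] s h zero    = refl
evens-[1-x²] s h (suc r) = square s (h (double (suc r))) (h (suc (double r))) (h (double r))
  where
  square : ∀ s a b c → a + s * b + - s * (b + s * c) ≡ a + - (s * s) * c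
  square = solve-∀

odds-[1-x²] : ∀ s h → odds ([1+ - s x]· [1+ s x]· h) ≗ [1+ - (s * s) x]· odds h
odds-[1-x²] s h zero    = square s (h 1) (h 0)
  where
  square : ∀ s a b → a + s * b + - s * b ≡ a
  square = solve-∀
odds-[1-x²] s h (suc r) = square s (h (suc (double (suc r)))) (h (double (suc r))) (h (suc (double r)))
  where
  square : ∀ s a b c → a + s * b + - s * (b + s * c) ≡ a + - (s * s) * c
  square = solve-∀

[1-x²]^-commute : ∀ s (P : Seq → Seq) → (∀ {f g} → f ≗ g → P f ≗ P g) →
  (∀ h → P ([1+ - s x]· [1+ s x]· h) ≗ [1+ - (s * s) x]· P h) →
  ∀ j h → P ([1+ - s x]^ j · [1+ s x]^ j · h) ≗ [1+ - (s * s) x]^ j · P h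
[1-x²]^-commute s P P-cong P-[1-x²] zero    h r = refl
[1-x²]^-commute s P P-cong P-[1-x²] (suc j) h r = begin
  P ([1+ - s x]· [1+ - s x]^ j · [1+ s x]· [1+ s x]^ j · h) r
    ≡⟨ P-cong (·-cong (- s) (^·-comm (- s) s j ([1+ s x]^ j · h))) r ⟩
  P ([1+ - s x]· [1+ s x]· [1+ - s x]^ j · [1+ s x]^ j · h) r
    ≡⟨ P-[1-x²] ([1+ - s x]^ j · [1+ s x]^ j · h) r ⟩
  ([1+ - (s * s) x]· P ([1+ - s x]^ j · [1+ s x]^ j · h)) r
    ≡⟨ ·-cong (- (s * s)) ([1-x²]^-commute s P P-cong P-[1-x²] j h) r ⟩
  ([1+ - (s * s) x]^ suc j · P h) r ∎
  where open ≡-Reasoning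

parity-reduction : ∀ k A B →
  [1+ -1ℤ x]^ k · evens ([1+ -1ℤ x]· A) ≗ evens B →
  [1+ -1ℤ x]^ k · odds ([1+ -1ℤ x]· A) ≗ odds B →
  [1+ -1ℤ x]^ (k ℕ.+ 1) · [1+ 1ℤ x]^ k · A ≗ B
parity-reduction k A B evens≗ odds≗ n = begin
  ([1+ -1ℤ x]^ (k ℕ.+ 1) · [1+ 1ℤ x]^ k · A) n
    ≡⟨ ^·-exp -1ℤ ([1+ 1ℤ x]^ k · A) (ℕₚ.+-comm k 1) n ⟩
  ([1+ -1ℤ x]· [1+ -1ℤ x]^ k · [1+ 1ℤ x]^ k · A) n
    ≡⟨ ^·-comm -1ℤ -1ℤ k ([1+ 1ℤ x]^ k · A) n ⟨
  ([1+ -1ℤ x]^ k · [1+ -1ℤ x]· [1+ 1ℤ x]^ k · A) n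
    ≡⟨ ^·-cong -1ℤ k (^·-comm 1ℤ -1ℤ k A) n ⟨
  ([1+ -1ℤ x]^ k · [1+ 1ℤ x]^ k · [1+ -1ℤ x]· A) n
    ≡⟨ ≗-byParity {f = [1+ -1ℤ x]^ k · [1+ 1ℤ x]^ k · [1+ -1ℤ x]· A}
         (λ r → trans ([1-x²]^-commute 1ℤ evens (λ f≗g → f≗g ∘ double) (evens-[1-x²] 1ℤ) k _ r) (evens≗ r))
         (λ r → trans ([1-x²]^-commute 1ℤ odds (λ f≗g → f≗g ∘ suc ∘ double) (odds-[1-x²] 1ℤ) k _ r) (odds≗ r))
         n ⟩
  B n ∎
  where open ≡-Reasoning

pascalℤ : ∀ n k → + (suc n C suc k) ≡ + (n C k) + + (n C suc k)
pascalℤ n k = trans (cong +_ (sym (nCk+nC[k+1]≡[n+1]C[k+1] n k))) (ℤₚ.pos-+ (n C k) (n C suc k))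

-- coefficients of (1 - x)^-(a+1)
invPow : ℕ → Seq
invPow a r = + ((r ℕ.+ a) C a)

invPow-zero : ∀ a → invPow a 0 ≡ 1ℤ
invPow-zero a = cong +_ (nCn≡1 a)

invPow-pascal : ∀ a r → invPow (suc a) (suc r) ≡ invPow (suc a) r + invPow a (suc r)
invPow-pascal a r = begin
  + (suc (r ℕ.+ suc a) C suc a)
    ≡⟨ pascalℤ (r ℕ.+ suc a) a ⟩
  + ((r ℕ.+ suc a) C a) + invPow (suc a) r
    ≡⟨ cong (λ n → + (n C a) + invPow (suc a) r) (ℕₚ.+-suc r a) ⟩
  invPow a (suc r) + invPow (suc a) r
    ≡⟨ ℤₚ.+-comm (invPow a (suc r)) (invPow (suc a) r) ⟩
  invPow (suc a) r + invPow a (suc r) ∎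
  where open ≡-Reasoning

[1-x]·invPow : ∀ a → [1+ -1ℤ x]· invPow (suc a) ≗ invPow a
[1-x]·invPow a zero    = trans (invPow-zero (suc a)) (sym (invPow-zero a))
[1-x]·invPow a (suc r) = trans (cong (_+ -1ℤ * invPow (suc a) r) (invPow-pascal a r))
                               (cancel (invPow (suc a) r) (invPow a (suc r)))
  where
  cancel : ∀ X y → X + y + -1ℤ * X ≡ y
  cancel = solve-∀

[1-x]^·invPow : ∀ a → [1+ -1ℤ x]^ suc a · invPow a ≗ δ
[1-x]^·invPow zero    zero    = refl
[1-x]^·invPow zero    (suc r) = refl
[1-x]^·invPow (suc a) r = begin
  ([1+ -1ℤ x]· [1+ -1ℤ x]^ suc a · invPow (suc a)) r  ≡⟨ ^·-comm -1ℤ -1ℤ (suc a) (invPow (suc a)) r ⟨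
  ([1+ -1ℤ x]^ suc a · [1+ -1ℤ x]· invPow (suc a)) r  ≡⟨ ^·-cong -1ℤ (suc a) ([1-x]·invPow a) r ⟩
  ([1+ -1ℤ x]^ suc a · invPow a) r                   ≡⟨ [1-x]^·invPow a r ⟩
  δ r                                                ∎
  where open ≡-Reasoning

invPowProd binomProd : ℕ → ℕ → Seq
invPowProd a b r = invPow a r * invPow b r
binomProd  a b i = + (a C i) * + (b C i)

invPowProd-zero : ∀ a b → invPowProd a b 0 ≡ 1ℤ
invPowProd-zero a b = cong₂ _*_ (invPow-zero a) (invPow-zero b)

[1-x]·invPowProd : ∀ a b →
  [1+ -1ℤ x]· invPowProd (suc a) (suc b) ≗ invPowProd a (suc b) +ₛ invPowProd (suc a) b -ₛ invPowProd a b
[1-x]·invPowProd a b zero = trans (invPowProd-zero (suc a) (suc b)) (sym (cong₂ _-_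
  (cong₂ _+_ (invPowProd-zero a (suc b)) (invPowProd-zero (suc a) b)) (invPowProd-zero a b)))
[1-x]·invPowProd a b (suc r) = begin
  X′ * Y′ + -1ℤ * (X * Y)
    ≡⟨ cong₂ (λ P Q → P * Q + -1ℤ * (X * Y)) (invPow-pascal a r) (invPow-pascal b r) ⟩
  (X + x) * (Y + y) + -1ℤ * (X * Y)
    ≡⟨ expand X x Y y ⟩
  x * (Y + y) + (X + x) * y - x * y
    ≡⟨ cong₂ (λ P Q → x * Q + P * y - x * y) (invPow-pascal a r) (invPow-pascal b r) ⟨
  x * Y′ + X′ * y - x * y ∎
  where
  open ≡-Reasoning
  X = invPow (suc a) r; x = invPow a (suc r); X′ = invPow (suc a) (suc r)
  Y = invPow (suc b) r; y = invPow b (suc r); Y′ = invPow (suc b) (suc r)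
  expand : ∀ X x Y y → (X + x) * (Y + y) + -1ℤ * (X * Y) ≡ x * (Y + y) + (X + x) * y - x * y
  expand = solve-∀

binomProd-pascal : ∀ a b →
  binomProd (suc a) (suc b) ≗ binomProd a (suc b) +ₛ binomProd (suc a) b -ₛ [1+ -1ℤ x]· binomProd a b
binomProd-pascal a b zero    = refl
binomProd-pascal a b (suc i) = begin
  A′ * B′                                                   ≡⟨ cong₂ _*_ (pascalℤ a i) (pascalℤ b i) ⟩
  (A₀ + A₁) * (B₀ + B₁)                                     ≡⟨ expand A₀ A₁ B₀ B₁ ⟩
  A₁ * (B₀ + B₁) + (A₀ + A₁) * B₁ - (A₁ * B₁ + -1ℤ * (A₀ * B₀))
    ≡⟨ cong₂ (λ P Q → A₁ * Q + P * B₁ - (A₁ * B₁ + -1ℤ * (A₀ * B₀))) (pascalℤ a i) (pascalℤ b i) ⟨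
  A₁ * B′ + A′ * B₁ - (A₁ * B₁ + -1ℤ * (A₀ * B₀))           ∎
  where
  open ≡-Reasoning
  A₀ = + (a C i); A₁ = + (a C suc i); A′ = + (suc a C suc i)
  B₀ = + (b C i); B₁ = + (b C suc i); B′ = + (suc b C suc i)
  expand : ∀ A₀ A₁ B₀ B₁ →
    (A₀ + A₁) * (B₀ + B₁) ≡ A₁ * (B₀ + B₁) + (A₀ + A₁) * B₁ - (A₁ * B₁ + -1ℤ * (A₀ * B₀))
  expand = solve-∀

binomProd-zeroˡ : ∀ b → binomProd 0 b ≗ δ
binomProd-zeroˡ b zero    = refl
binomProd-zeroˡ b (suc i) = refl

binomProd-zeroʳ : ∀ a → binomProd a 0 ≗ δ
binomProd-zeroʳ a zero    = refl
binomProd-zeroʳ a (suc i) = ℤₚ.*-zeroʳ (+ (a C suc i))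

narayana : ∀ a b → [1+ -1ℤ x]^ suc (a ℕ.+ b) · invPowProd a b ≗ binomProd a b
narayana zero b r = begin
  ([1+ -1ℤ x]^ suc b · invPowProd 0 b) r  ≡⟨ ^·-cong -1ℤ (suc b) (ℤₚ.*-identityˡ ∘ invPow b) r ⟩
  ([1+ -1ℤ x]^ suc b · invPow b) r        ≡⟨ [1-x]^·invPow b r ⟩
  δ r                                     ≡⟨ binomProd-zeroˡ b r ⟨
  binomProd 0 b r                         ∎
  where open ≡-Reasoning
narayana (suc a) zero r = begin
  ([1+ -1ℤ x]^ suc (suc a ℕ.+ 0) · invPowProd (suc a) 0) r
    ≡⟨ ^·-exp -1ℤ (invPowProd (suc a) 0) (cong suc (ℕₚ.+-identityʳ (suc a))) r ⟩
  ([1+ -1ℤ x]^ suc (suc a) · invPowProd (suc a) 0) r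
    ≡⟨ ^·-cong -1ℤ (suc (suc a)) (ℤₚ.*-identityʳ ∘ invPow (suc a)) r ⟩
  ([1+ -1ℤ x]^ suc (suc a) · invPow (suc a)) r
    ≡⟨ [1-x]^·invPow (suc a) r ⟩
  δ r
    ≡⟨ binomProd-zeroʳ (suc a) r ⟨
  binomProd (suc a) 0 r ∎
  where open ≡-Reasoning
narayana (suc a) (suc b) r = begin
  ([1+ -1ℤ x]· Δ (F (suc a) (suc b))) r
    ≡⟨ ^·-comm -1ℤ -1ℤ (suc e) (F (suc a) (suc b)) r ⟨
  Δ ([1+ -1ℤ x]· F (suc a) (suc b)) r
    ≡⟨ ^·-cong -1ℤ (suc e) ([1-x]·invPowProd a b) r ⟩
  Δ (F a (suc b) +ₛ F (suc a) b -ₛ F a b) r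
    ≡⟨ ^·--ₛ -1ℤ (suc e) (F a (suc b) +ₛ F (suc a) b) (F a b) r ⟩
  Δ (F a (suc b) +ₛ F (suc a) b) r - Δ (F a b) r
    ≡⟨ cong (_- Δ (F a b) r) (^·-+ₛ -1ℤ (suc e) (F a (suc b)) (F (suc a) b) r) ⟩
  Δ (F a (suc b)) r + Δ (F (suc a) b) r - Δ (F a b) r
    ≡⟨ cong₂ _-_ (cong₂ _+_ (narayana a (suc b) r)
                            (trans (^·-exp -1ℤ (F (suc a) b) e≡ r) (narayana (suc a) b r)))
                 (trans (^·-exp -1ℤ (F a b) e≡ r) (·-cong -1ℤ (narayana a b) r)) ⟩
  binomProd a (suc b) r + binomProd (suc a) b r - ([1+ -1ℤ x]· binomProd a b) r
    ≡⟨ binomProd-pascal a b r ⟨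
  binomProd (suc a) (suc b) r ∎
  where
  open ≡-Reasoning
  F = invPowProd
  e = a ℕ.+ suc b
  e≡ : suc e ≡ suc (suc (a ℕ.+ b))
  e≡ = cong suc (ℕₚ.+-suc a b)
  Δ : Seq → Seq
  Δ f = [1+ -1ℤ x]^ suc e · f

narayana-shifted : ∀ q b → [1+ -1ℤ x]^ suc (suc (q ℕ.+ b)) · (λ r → invPow q (suc r) * invPow (suc b) r)
                           ≗ λ r → + (suc q C suc r) * + (b C r)
narayana-shifted q b r = begin
  ([1+ -1ℤ x]^ k · (λ r → invPow q (suc r) * invPow (suc b) r)) r
    ≡⟨ ^·-cong -1ℤ k shifted≗ r ⟩
  ([1+ -1ℤ x]^ k · (u ∘ suc)) r
    ≡⟨ ^·-∘suc -1ℤ k u u-zero r ⟩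
  ([1+ -1ℤ x]^ k · u) (suc r)
    ≡⟨ ^·--ₛ -1ℤ k (invPowProd q (suc b)) (invPowProd q b) (suc r) ⟩
  ([1+ -1ℤ x]^ k · invPowProd q (suc b)) (suc r) - ([1+ -1ℤ x]^ k · invPowProd q b) (suc r)
    ≡⟨ cong₂ _-_ (trans (sym (^·-exp -1ℤ (invPowProd q (suc b)) (cong suc (ℕₚ.+-suc q b)) (suc r)))
                        (narayana q (suc b) (suc r)))
                 (·-cong -1ℤ (narayana q b) (suc r)) ⟩
  Q₁ * B′ - (Q₁ * B₁ + -1ℤ * (Q₀ * B₀))
    ≡⟨ cong (λ P → Q₁ * P - (Q₁ * B₁ + -1ℤ * (Q₀ * B₀))) (pascalℤ b r) ⟩
  Q₁ * (B₀ + B₁) - (Q₁ * B₁ + -1ℤ * (Q₀ * B₀))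
    ≡⟨ collect Q₀ Q₁ B₀ B₁ ⟩
  (Q₀ + Q₁) * B₀
    ≡⟨ cong (_* B₀) (pascalℤ q r) ⟨
  + (suc q C suc r) * B₀ ∎
  where
  open ≡-Reasoning
  k = suc (suc (q ℕ.+ b))
  Q₀ = + (q C r); Q₁ = + (q C suc r)
  B₀ = + (b C r); B₁ = + (b C suc r); B′ = + (suc b C suc r)
  -- By Pascal's rule the summand is u ∘ suc, and u 0 = 0; narayana applies to both terms of u.
  u : Seq
  u = invPowProd q (suc b) -ₛ invPowProd q b
  u-zero : u 0 ≡ 0ℤ
  u-zero = cong₂ _-_ (invPowProd-zero q (suc b)) (invPowProd-zero q b)
  shifted≗ : (λ r → invPow q (suc r) * invPow (suc b) r) ≗ u ∘ suc
  shifted≗ r = trans (split (invPow q (suc r)) (invPow (suc b) r) (invPow b (suc r)))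
                     (sym (cong (λ P → invPow q (suc r) * P - invPowProd q b (suc r)) (invPow-pascal b r)))
    where
    split : ∀ x Y y → x * Y ≡ x * (Y + y) - x * y
    split = solve-∀
  collect : ∀ Q₀ Q₁ B₀ B₁ → Q₁ * (B₀ + B₁) - (Q₁ * B₁ + -1ℤ * (Q₀ * B₀)) ≡ (Q₀ + Q₁) * B₀
  collect = solve-∀

double≡+ : ∀ n → double n ≡ n ℕ.+ n
double≡+ zero    = refl
double≡+ (suc n) = cong suc (trans (cong suc (double≡+ n)) (sym (ℕₚ.+-suc n n)))

double+/2 : ∀ r m → (double r ℕ.+ m) / 2 ≡ r ℕ.+ m / 2
double+/2 zero    m = refl
double+/2 (suc r) m =
  trans (m/n≡1+[m∸n]/n {suc (suc (double r ℕ.+ m))} {2} (s≤s (s≤s z≤n))) (cong suc (double+/2 r m))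

double/2 : ∀ r → double r / 2 ≡ r
double/2 r = trans (cong (_/ 2) (sym (ℕₚ.+-identityʳ (double r))))
                   (trans (double+/2 r 0) (ℕₚ.+-identityʳ r))

double+1/2 : ∀ r → (double r ℕ.+ 1) / 2 ≡ r
double+1/2 r = trans (double+/2 r 1) (ℕₚ.+-identityʳ r)

1+double/2 : ∀ r → suc (double r) / 2 ≡ r
1+double/2 r = trans (cong (_/ 2) (ℕₚ.+-comm 1 (double r))) (double+1/2 r)

1+double+1/2 : ∀ r → (suc (double r) ℕ.+ 1) / 2 ≡ suc r
1+double+1/2 r = trans (cong (λ n → suc n / 2) (ℕₚ.+-comm (double r) 1)) (double/2 (suc r))

lhs-evens : ∀ k → evens (lhs k) ≗ invPowProd (k / 2) ((k ℕ.+ 1) / 2)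
lhs-evens k r = trans
  (cong₂ (λ n n′ → + ((n C (k / 2)) ℕ.* (n′ C ((k ℕ.+ 1) / 2))))
         (double+/2 r k)
         (trans (cong (_/ 2) (ℕₚ.+-assoc (double r) k 1)) (double+/2 r (k ℕ.+ 1))))
  (ℤₚ.pos-* ((r ℕ.+ k / 2) C (k / 2)) ((r ℕ.+ (k ℕ.+ 1) / 2) C ((k ℕ.+ 1) / 2)))

lhs-odds : ∀ k → odds (lhs k) ≗
  λ r → + ((r ℕ.+ (k ℕ.+ 1) / 2) C (k / 2)) * + ((suc r ℕ.+ k / 2) C ((k ℕ.+ 1) / 2))
lhs-odds k r = trans
  (cong₂ (λ n n′ → + ((n C (k / 2)) ℕ.* (n′ C ((k ℕ.+ 1) / 2))))
         (trans (cong (_/ 2) (trans (sym (ℕₚ.+-suc (double r) k)) (cong (double r ℕ.+_) (ℕₚ.+-comm 1 k))))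
                (double+/2 r (k ℕ.+ 1)))
         (trans (cong (λ n → suc n / 2) (ℕₚ.+-comm (double r ℕ.+ k) 1)) (double+/2 (suc r) k)))
  (ℤₚ.pos-* ((r ℕ.+ (k ℕ.+ 1) / 2) C (k / 2)) ((suc r ℕ.+ k / 2) C ((k ℕ.+ 1) / 2)))

rhsCoeff-uncut : ∀ k j → rhsCoeff k j ≡ (((k ∸ 1) / 2) C (j / 2)) ℕ.* ((k / 2) C ((j ℕ.+ 1) / 2))
rhsCoeff-uncut k j with j ℕ.≤ᵇ k in j≤ᵇk
... | true  = refl
... | false = sym (trans (cong ((((k ∸ 1) / 2) C (j / 2)) ℕ.*_) (k>n⇒nCk≡0 k/2<[j+1]/2))
                         (ℕₚ.*-zeroʳ (((k ∸ 1) / 2) C (j / 2))))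
  where
  j≰k : ¬ j ≤ k
  j≰k j≤k = subst T j≤ᵇk (ℕₚ.≤⇒≤ᵇ j≤k)
  k/2<[j+1]/2 : k / 2 ℕ.< (j ℕ.+ 1) / 2
  k/2<[j+1]/2 = ℕₚ.≤-trans (ℕₚ.≤-reflexive (sym (double+/2 1 k)))
                          (/-monoˡ-≤ 2 (ℕₚ.≤-trans (s≤s (ℕₚ.≰⇒> j≰k)) (ℕₚ.≤-reflexive (ℕₚ.+-comm 1 j))))

rhs-evens : ∀ k → evens (rhs k) ≗ λ r → + (((k ∸ 1) / 2) C r) * + ((k / 2) C r)
rhs-evens k r = trans (cong +_ (trans (rhsCoeff-uncut k (double r))
  (cong₂ (λ i i′ → (((k ∸ 1) / 2) C i) ℕ.* ((k / 2) C i′)) (double/2 r) (double+1/2 r))))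
  (ℤₚ.pos-* (((k ∸ 1) / 2) C r) ((k / 2) C r))

rhs-odds : ∀ k → odds (rhs k) ≗ λ r → + (((k ∸ 1) / 2) C r) * + ((k / 2) C suc r)
rhs-odds k r = trans (cong +_ (trans (rhsCoeff-uncut k (suc (double r)))
  (cong₂ (λ i i′ → (((k ∸ 1) / 2) C i) ℕ.* ((k / 2) C i′)) (1+double/2 r) (1+double+1/2 r))))
  (ℤₚ.pos-* (((k ∸ 1) / 2) C r) ((k / 2) C suc r))

module EvenDegree (q : ℕ) where
  a k : ℕ
  a = suc q
  k = double a

  lhs-evens′ : evens (lhs k) ≗ invPowProd a a
  lhs-evens′ r = trans (lhs-evens k r) (cong₂ (λ h h′ → invPowProd h h′ r) (double/2 a) (double+1/2 a))

  lhs-odds′ : odds (lhs k) ≗ λ r → invPow a r * invPow a (suc r)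
  lhs-odds′ r = trans (lhs-odds k r)
    (cong₂ (λ h h′ → + ((r ℕ.+ h′) C h) * + ((suc r ℕ.+ h) C h′)) (double/2 a) (double+1/2 a))

  rhs-halves : ∀ i i′ → + (((k ∸ 1) / 2) C i) * + ((k / 2) C i′) ≡ + (q C i) * + (a C i′)
  rhs-halves i i′ = cong₂ (λ h h′ → + (h C i) * + (h′ C i′)) (1+double/2 q) (double/2 a)

  k≡ : k ≡ suc (suc (q ℕ.+ q))
  k≡ = cong (suc ∘ suc) (double≡+ q)

  evens-identity : [1+ -1ℤ x]^ k · evens ([1+ -1ℤ x]· lhs k) ≗ evens (rhs k)
  evens-identity r = begin
    ([1+ -1ℤ x]^ k · evens ([1+ -1ℤ x]· lhs k)) r   ≡⟨ ^·-cong -1ℤ k lhs-diff r ⟩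
    ([1+ -1ℤ x]^ k · invPowProd a q) r              ≡⟨ ^·-exp -1ℤ (invPowProd a q) k≡ r ⟩
    ([1+ -1ℤ x]^ suc (a ℕ.+ q) · invPowProd a q) r  ≡⟨ narayana a q r ⟩
    + (a C r) * + (q C r)                           ≡⟨ ℤₚ.*-comm (+ (a C r)) (+ (q C r)) ⟩
    + (q C r) * + (a C r)                           ≡⟨ trans (rhs-evens k r) (rhs-halves r r) ⟨
    evens (rhs k) r                                 ∎
    where
    open ≡-Reasoning
    lhs-diff : evens ([1+ -1ℤ x]· lhs k) ≗ invPowProd a q
    lhs-diff zero    = trans (lhs-evens′ 0) (trans (invPowProd-zero a a) (sym (invPowProd-zero a q)))
    lhs-diff (suc r) = begin
      lhs k (double (suc r)) + -1ℤ * lhs k (suc (double r))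
        ≡⟨ cong₂ (λ u v → u + -1ℤ * v) (lhs-evens′ (suc r)) (lhs-odds′ r) ⟩
      Z * Z + -1ℤ * (X * Z)
        ≡⟨ factor X Z ⟩
      Z * (Z + -1ℤ * X)
        ≡⟨ cong (Z *_) ([1-x]·invPow q (suc r)) ⟩
      Z * invPow q (suc r) ∎
      where
      X = invPow a r; Z = invPow a (suc r)
      factor : ∀ X Z → Z * Z + -1ℤ * (X * Z) ≡ Z * (Z + -1ℤ * X)
      factor = solve-∀

  odds-identity : [1+ -1ℤ x]^ k · odds ([1+ -1ℤ x]· lhs k) ≗ odds (rhs k)
  odds-identity r = begin
    ([1+ -1ℤ x]^ k · odds ([1+ -1ℤ x]· lhs k)) r
      ≡⟨ ^·-cong -1ℤ k lhs-diff r ⟩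
    ([1+ -1ℤ x]^ k · (λ r → invPow q (suc r) * invPow a r)) r
      ≡⟨ ^·-exp -1ℤ (λ r → invPow q (suc r) * invPow a r) k≡ r ⟩
    ([1+ -1ℤ x]^ suc (suc (q ℕ.+ q)) · (λ r → invPow q (suc r) * invPow a r)) r
      ≡⟨ narayana-shifted q q r ⟩
    + (a C suc r) * + (q C r)
      ≡⟨ ℤₚ.*-comm (+ (a C suc r)) (+ (q C r)) ⟩
    + (q C r) * + (a C suc r)
      ≡⟨ trans (rhs-odds k r) (rhs-halves r (suc r)) ⟨
    odds (rhs k) r ∎
    where
    open ≡-Reasoning
    lhs-diff : odds ([1+ -1ℤ x]· lhs k) ≗ λ r → invPow q (suc r) * invPow a r
    lhs-diff r = begin
      lhs k (suc (double r)) + -1ℤ * lhs k (double r)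
        ≡⟨ cong₂ (λ u v → u + -1ℤ * v) (lhs-odds′ r) (lhs-evens′ r) ⟩
      X * Z + -1ℤ * (X * X)
        ≡⟨ factor X Z ⟩
      (Z + -1ℤ * X) * X
        ≡⟨ cong (_* X) ([1-x]·invPow q (suc r)) ⟩
      invPow q (suc r) * X ∎
      where
      X = invPow a r; Z = invPow a (suc r)
      factor : ∀ X Z → X * Z + -1ℤ * (X * X) ≡ (Z + -1ℤ * X) * X
      factor = solve-∀

module OddDegree (p : ℕ) where
  k : ℕ
  k = suc (double p)

  lhs-evens′ : evens (lhs k) ≗ invPowProd p (suc p)
  lhs-evens′ r = trans (lhs-evens k r) (cong₂ (λ h h′ → invPowProd h h′ r) (1+double/2 p) (1+double+1/2 p))

  lhs-odds′ : odds (lhs k) ≗ λ r → invPow p (suc r) * invPow (suc p) r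
  lhs-odds′ r = trans (lhs-odds k r) (trans
    (cong₂ (λ h h′ → + ((r ℕ.+ h′) C h) * + ((suc r ℕ.+ h) C h′)) (1+double/2 p) (1+double+1/2 p))
    (cong₂ (λ n n′ → + (n C p) * + (n′ C suc p)) (ℕₚ.+-suc r p) (sym (ℕₚ.+-suc r p))))

  rhs-halves : ∀ i i′ → + (((k ∸ 1) / 2) C i) * + ((k / 2) C i′) ≡ + (p C i) * + (p C i′)
  rhs-halves i i′ = cong₂ (λ h h′ → + (h C i) * + (h′ C i′)) (double/2 p) (1+double/2 p)

  evens-identity : [1+ -1ℤ x]^ k · evens ([1+ -1ℤ x]· lhs k) ≗ evens (rhs k)
  evens-identity r = begin
    ([1+ -1ℤ x]^ k · evens ([1+ -1ℤ x]· lhs k)) r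
      ≡⟨ ^·-cong -1ℤ k lhs-diff r ⟩
    ([1+ -1ℤ x]^ k · invPowProd p p) r
      ≡⟨ ^·-exp -1ℤ (invPowProd p p) (cong suc (double≡+ p)) r ⟩
    ([1+ -1ℤ x]^ suc (p ℕ.+ p) · invPowProd p p) r
      ≡⟨ narayana p p r ⟩
    + (p C r) * + (p C r)
      ≡⟨ trans (rhs-evens k r) (rhs-halves r r) ⟨
    evens (rhs k) r ∎
    where
    open ≡-Reasoning
    lhs-diff : evens ([1+ -1ℤ x]· lhs k) ≗ invPowProd p p
    lhs-diff zero    = trans (lhs-evens′ 0) (trans (invPowProd-zero p (suc p)) (sym (invPowProd-zero p p)))
    lhs-diff (suc r) = begin
      lhs k (double (suc r)) + -1ℤ * lhs k (suc (double r))
        ≡⟨ cong₂ (λ u v → u + -1ℤ * v) (lhs-evens′ (suc r)) (lhs-odds′ r) ⟩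
      X * Z + -1ℤ * (X * Y)
        ≡⟨ factor X Y Z ⟩
      X * (Z + -1ℤ * Y)
        ≡⟨ cong (X *_) ([1-x]·invPow p (suc r)) ⟩
      X * X ∎
      where
      X = invPow p (suc r); Y = invPow (suc p) r; Z = invPow (suc p) (suc r)
      factor : ∀ X Y Z → X * Z + -1ℤ * (X * Y) ≡ X * (Z + -1ℤ * Y)
      factor = solve-∀

  lhs-diff-odds : odds ([1+ -1ℤ x]· lhs k) ≗ λ r → (invPow p (suc r) + -1ℤ * invPow p r) * invPow (suc p) r
  lhs-diff-odds r = trans (cong₂ (λ u v → u + -1ℤ * v) (lhs-odds′ r) (lhs-evens′ r))
                          (factor (invPow p (suc r)) (invPow p r) (invPow (suc p) r))
    where
    factor : ∀ X′ X Y → X′ * Y + -1ℤ * (X * Y) ≡ (X′ + -1ℤ * X) * Y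
    factor = solve-∀

odds-identity-k≡1 : [1+ -1ℤ x]^ 1 · odds ([1+ -1ℤ x]· lhs 1) ≗ odds (rhs 1)
odds-identity-k≡1 r = begin
  ([1+ -1ℤ x]· odds ([1+ -1ℤ x]· lhs 1)) r
    ≡⟨ ·-cong -1ℤ (λ r → trans (OddDegree.lhs-diff-odds 0 r) (cancel (invPow 1 r))) r ⟩
  ([1+ -1ℤ x]· (λ _ → 0ℤ)) r
    ≡⟨ zero≡ r ⟩
  0ℤ
    ≡⟨ trans (rhs-odds 1 r) (ℤₚ.*-zeroʳ (+ (0 C r))) ⟨
  odds (rhs 1) r ∎
  where
  open ≡-Reasoning
  cancel : ∀ Y → (1ℤ + -1ℤ * 1ℤ) * Y ≡ 0ℤ
  cancel = solve-∀
  zero≡ : ∀ r → ([1+ -1ℤ x]· (λ _ → 0ℤ)) r ≡ 0ℤ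
  zero≡ zero    = refl
  zero≡ (suc r) = refl

odds-identity-k≥3 : ∀ q → let open OddDegree (suc q) in
  [1+ -1ℤ x]^ k · odds ([1+ -1ℤ x]· lhs k) ≗ odds (rhs k)
odds-identity-k≥3 q r = begin
  ([1+ -1ℤ x]^ k · odds ([1+ -1ℤ x]· lhs k)) r
    ≡⟨ ^·-cong -1ℤ k (λ r → trans (lhs-diff-odds r) (cong (_* invPow (suc p) r) ([1-x]·invPow q (suc r)))) r ⟩
  ([1+ -1ℤ x]^ k · (λ r → invPow q (suc r) * invPow (suc p) r)) r
    ≡⟨ ^·-exp -1ℤ (λ r → invPow q (suc r) * invPow (suc p) r) k≡ r ⟩
  ([1+ -1ℤ x]^ suc (suc (q ℕ.+ p)) · (λ r → invPow q (suc r) * invPow (suc p) r)) r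
    ≡⟨ narayana-shifted q p r ⟩
  + (p C suc r) * + (p C r)
    ≡⟨ ℤₚ.*-comm (+ (p C suc r)) (+ (p C r)) ⟩
  + (p C r) * + (p C suc r)
    ≡⟨ trans (rhs-odds k r) (rhs-halves r (suc r)) ⟨
  odds (rhs k) r ∎
  where
  open ≡-Reasoning
  open OddDegree (suc q)
  p : ℕ
  p = suc q
  k≡ : k ≡ suc (suc (q ℕ.+ p))
  k≡ = cong (suc ∘ suc) (trans (cong suc (double≡+ q)) (sym (ℕₚ.+-suc q q)))

univariate : ∀ k → 1 ≤ k → [1+ -1ℤ x]^ (k ℕ.+ 1) · [1+ 1ℤ x]^ k · lhs k ≗ rhs k
univariate k 1≤k with parityView k
univariate .0 () | even zero
... | even (suc q) = parity-reduction k (lhs k) (rhs k)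
                       (EvenDegree.evens-identity q) (EvenDegree.odds-identity q)
... | odd zero     = parity-reduction 1 (lhs 1) (rhs 1)
                       (OddDegree.evens-identity 0) odds-identity-k≡1
... | odd (suc q)  = parity-reduction k (lhs k) (rhs k)
                       (OddDegree.evens-identity (suc q)) (odds-identity-k≥3 q)

mainTheorem16 : (k : ℕ) → 1 ≤ k → (n m : ℕ) → LHS k n m ≡ RHS k n m
mainTheorem16 k 1≤k n m = trans (LHS≋diag k n m) (diag-cong k (univariate k 1≤k) n m)
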